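{- Let $k$ be a positive integer and let $D$ be a connected digraph of order $n\ge\max\{k,2\}$. Then $\gamma_{rk}(D)\le\gamma_{trk}(D)\le 2\gamma_{rk}(D)-k+1$, and these bounds are sharp (for every positive integer $k$, each of the two inequalities holds with equality for some connected digraph of order at least $\max\{k,2\}$).
   Context: All digraphs are finite, without loops or multiple arcs (pairs of opposite arcs are allowed); connected means the underlying undirected graph is connected. $N^-(v)$ is the set of in-neighbors of $v$. A vertex is isolated if it has no in- or out-neighbors. A $k$-rainbow dominating function ($k$RDF) on $D$ is a function $f:V(D)\to\mathcal{P}(\{1,\dots,k\})$ such that every $v$ with $f(v)=\emptyset$ satisfies $\bigcup_{u\in N^-(v)}f(u)=\{1,\dots,k\}$; its weight is $\omega(f)=\sum_v|f(v)|$, and $\gamma_{rk}(D)$ is the minimum weight of a $k$RDF. For $D$ with no isolated vertex, a total $k$RDF (T$k$RDF) is a $k$RDF $f$ such that the subdigraph induced by $\{v:f(v)\neq\emptyset\}$ has no isolated vertex; $\gamma_{trk}(D)$ is the minimum weight of a T$k$RDF. -}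

module Defs where

open import Data.Nat using (ℕ; _+_; _≤_)
open import Data.Nat.ListAction using (sum)
open import Data.Bool using (Bool; true; false)
open import Data.Fin using (Fin)
open import Data.Fin.Subset using (Subset; ⊥; _∈_; ∣_∣)
open import Data.Product using (Σ; ∃; _×_; _,_)
open import Data.Sum using (_⊎_)
open import Relation.Binary.PropositionalEquality using (_≡_)
open import Relation.Nullary using (¬_)
import Data.List as List

-- A digraph on vertex set Fin n: arc u v ≡ true means there is an arc u → v.
-- No loops; multiple arcs are impossible by construction; opposite arcs allowed.
record Digraph (n : ℕ) : Set where
  field
    arc      : Fin n → Fin n → Bool
    loopless : ∀ v → arc v v ≡ false
open Digraph public

Adj : ∀ {n} → Digraph n → Fin n → Fin n → Set
Adj D u v = (arc D u v ≡ true) ⊎ (arc D v u ≡ true)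

data Reach {n : ℕ} (D : Digraph n) : Fin n → Fin n → Set where
  here : ∀ {u} → Reach D u u
  step : ∀ {u v w} → Adj D u v → Reach D v w → Reach D u w

Connected : ∀ {n} → Digraph n → Set
Connected D = ∀ u v → Reach D u v

Assignment : ℕ → ℕ → Set
Assignment n k = Fin n → Subset k

weight : ∀ {n k} → Assignment n k → ℕ
weight {n} f = sum (List.map (λ v → ∣ f v ∣) (List.allFin n))

IsRDF : ∀ {n k} → Digraph n → Assignment n k → Set
IsRDF {n} {k} D f =
  ∀ (v : Fin n) → f v ≡ ⊥ → ∀ (c : Fin k) →
    ∃ λ (u : Fin n) → (arc D u v ≡ true) × (c ∈ f u)

-- total kRDF: additionally the subdigraph induced by vertices with nonempty
-- label has no isolated vertex
IsTRDF : ∀ {n k} → Digraph n → Assignment n k → Set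
IsTRDF {n} {k} D f =
  IsRDF D f ×
  (∀ (v : Fin n) → ¬ (f v ≡ ⊥) →
     ∃ λ (u : Fin n) → ¬ (f u ≡ ⊥) × Adj D u v)

IsγRk : ∀ {n} → (k : ℕ) → Digraph n → ℕ → Set
IsγRk {n} k D m =
  (∃ λ (f : Assignment n k) → IsRDF D f × weight f ≡ m) ×
  (∀ (f : Assignment n k) → IsRDF D f → m ≤ weight f)

IsγtRk : ∀ {n} → (k : ℕ) → Digraph n → ℕ → Set
IsγtRk {n} k D m =
  (∃ λ (f : Assignment n k) → IsTRDF D f × weight f ≡ m) ×
  (∀ (f : Assignment n k) → IsTRDF D f → m ≤ weight f)

module Submission where

-- Every kRDF f is repaired into a total one. If no vertex is unlabelled, f is already total and
-- k ≤ n ≤ ω(f). Otherwise fix an unlabelled vertex w, give w the first colour, and for every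
-- labelled v that is not an in-neighbour of w give the first colour to some neighbour of v. Such a
-- v pays for the unit it adds out of its own label, while the in-neighbours of w carry at least k
-- labels that pay for nothing, so the repair costs at most 1 + ω(f) − k.
-- Sharpness: γ_rk = γ_trk for the out-star on k ≥ 2 vertices (label every vertex by the first
-- colour) and for the path 0 → 1 → 2 when k = 1; the out-star on k + 1 vertices has γ_rk = k and
-- γ_trk = k + 1.

open import Defs
open import Data.Nat using (ℕ; zero; suc; _+_; _*_; _≤_; _⊔_; z≤n; s≤s)
open import Data.Nat.Properties
open import Algebra.Properties.CommutativeMonoid.Sum +-0-commutativeMonoid
  using (sum; sum-cong-≗; sum-remove; sum-replicate-zero; ∑-distrib-+)
import Data.Nat.ListAction as ListAction
open import Data.Bool using (Bool; true; false; if_then_else_)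
import Data.Bool as Bool
open import Data.Fin using (Fin; zero; suc; punchIn)
open import Data.Fin.Properties using (any?; punchInᵢ≢i)
open import Data.Fin.Subset using (Subset; ⊥; ⊤; _∈_; _⊆_; ∣_∣; _∪_; ⁅_⁆)
open import Data.Fin.Subset.Properties
  using (∉⊥; ∈⊤; ∣⊥∣≡0; ∣⊤∣≡n; ∣⁅x⁆∣≡1; x∈⁅x⁆; x∈⁅y⁆⇒x≡y; p⊆q⇒∣p∣≤∣q∣; p⊆p∪q; q⊆p∪q;
         nonempty?; Empty-unique)
open import Data.Vec using ([]; _∷_)
open import Data.Vec.Properties using (≡-dec)
open import Data.Vec.Functional as Vector using (Vector; replicate; updateAt)
open import Data.Vec.Functional.Properties using (updateAt-updates)
import Data.List as List
import Data.List.Properties as List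
open import Data.Product using (Σ; ∃; _×_; _,_; proj₁; proj₂)
open import Data.Sum using (inj₁; inj₂)
open import Function using (_∘_; id; const)
open import Relation.Binary.PropositionalEquality
open import Relation.Nullary using (¬_; Dec; yes; no; contradiction)
open import Data.Nat.Solver using (module +-*-Solver)
open +-*-Solver using (solve; _:+_; _:*_; _:=_; con)

∑-mono-≤ : ∀ {n} {s t : Vector ℕ n} → (∀ i → s i ≤ t i) → sum s ≤ sum t
∑-mono-≤ {zero}  _     = z≤n
∑-mono-≤ {suc n} s≤t = +-mono-≤ (s≤t zero) (∑-mono-≤ (s≤t ∘ suc))

∑-ones : ∀ n → sum (replicate n 1) ≡ n
∑-ones zero    = refl
∑-ones (suc n) = cong suc (∑-ones n)

lookup≤∑ : ∀ {n} (t : Vector ℕ (suc n)) i → t i ≤ sum t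
lookup≤∑ t i = ≤-trans (m≤m+n (t i) _) (≤-reflexive (sym (sum-remove {i = i} t)))

listSum-tabulate : ∀ {n} (t : Vector ℕ n) → ListAction.sum (List.tabulate t) ≡ sum t
listSum-tabulate {zero}  t = refl
listSum-tabulate {suc n} t = cong (t zero +_) (listSum-tabulate (t ∘ suc))

weight≡∑ : ∀ {n k} (f : Assignment n k) → weight f ≡ sum (λ v → ∣ f v ∣)
weight≡∑ f = trans (cong ListAction.sum (List.map-tabulate id (λ v → ∣ f v ∣)))
                   (listSum-tabulate (λ v → ∣ f v ∣))

∣p∪q∣≤∣p∣+∣q∣ : ∀ {k} (p q : Subset k) → ∣ p ∪ q ∣ ≤ ∣ p ∣ + ∣ q ∣
∣p∪q∣≤∣p∣+∣q∣ []          []          = z≤n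
∣p∪q∣≤∣p∣+∣q∣ (true ∷ p)  (true ∷ q)  = s≤s (≤-trans (∣p∪q∣≤∣p∣+∣q∣ p q) (+-monoʳ-≤ ∣ p ∣ (n≤1+n ∣ q ∣)))
∣p∪q∣≤∣p∣+∣q∣ (true ∷ p)  (false ∷ q) = s≤s (∣p∪q∣≤∣p∣+∣q∣ p q)
∣p∪q∣≤∣p∣+∣q∣ (false ∷ p) (true ∷ q)  =
  subst (suc ∣ p ∪ q ∣ ≤_) (sym (+-suc ∣ p ∣ ∣ q ∣)) (s≤s (∣p∪q∣≤∣p∣+∣q∣ p q))
∣p∪q∣≤∣p∣+∣q∣ (false ∷ p) (false ∷ q) = ∣p∪q∣≤∣p∣+∣q∣ p q

_≟⊥ : ∀ {k} (p : Subset k) → Dec (p ≡ ⊥)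
p ≟⊥ = ≡-dec Bool._≟_ p ⊥

x∈p⇒p≢⊥ : ∀ {k} {x : Fin k} {p : Subset k} → x ∈ p → ¬ p ≡ ⊥
x∈p⇒p≢⊥ x∈p refl = ∉⊥ x∈p

p≢⊥⇒1≤∣p∣ : ∀ {k} {p : Subset k} → ¬ p ≡ ⊥ → 1 ≤ ∣ p ∣
p≢⊥⇒1≤∣p∣ {p = p} p≢⊥ with nonempty? p
... | no  empty      = contradiction (Empty-unique empty) p≢⊥
... | yes (x , x∈p) = subst (_≤ ∣ p ∣) (∣⁅x⁆∣≡1 x) (p⊆q⇒∣p∣≤∣q∣ ⁅x⁆⊆p)
  where
  ⁅x⁆⊆p : ⁅ x ⁆ ⊆ p
  ⁅x⁆⊆p y∈⁅x⁆ = subst (_∈ p) (sym (x∈⁅y⁆⇒x≡y x y∈⁅x⁆)) x∈p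

p⊆q⇒q≡⊥⇒p≡⊥ : ∀ {k} {p q : Subset k} → p ⊆ q → q ≡ ⊥ → p ≡ ⊥
p⊆q⇒q≡⊥⇒p≡⊥ p⊆q refl = Empty-unique (λ (_ , x∈p) → ∉⊥ (p⊆q x∈p))

⊤⊆p⇒n≤∣p∣ : ∀ {k} {p : Subset k} → ⊤ ⊆ p → k ≤ ∣ p ∣
⊤⊆p⇒n≤∣p∣ {k} {p} ⊤⊆p = subst (_≤ ∣ p ∣) (∣⊤∣≡n k) (p⊆q⇒∣p∣≤∣q∣ ⊤⊆p)

⋃ᵥ : ∀ {m k} → Vector (Subset k) m → Subset k
⋃ᵥ = Vector.foldr _∪_ ⊥

∣⋃ᵥ∣≤∑ : ∀ {m k} (F : Vector (Subset k) m) → ∣ ⋃ᵥ F ∣ ≤ sum (∣_∣ ∘ F)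
∣⋃ᵥ∣≤∑ {zero} {k} F = ≤-reflexive (∣⊥∣≡0 k)
∣⋃ᵥ∣≤∑ {suc m}    F = ≤-trans (∣p∪q∣≤∣p∣+∣q∣ (F zero) _) (+-monoʳ-≤ ∣ F zero ∣ (∣⋃ᵥ∣≤∑ (F ∘ suc)))

∈⋃ᵥ : ∀ {m k} (F : Vector (Subset k) m) i → F i ⊆ ⋃ᵥ F
∈⋃ᵥ F zero    = p⊆p∪q _
∈⋃ᵥ F (suc i) = q⊆p∪q (F zero) _ ∘ ∈⋃ᵥ (F ∘ suc) i

module _ {n k : ℕ} where

  ∅ₐ : Assignment n k
  ∅ₐ _ = ⊥

  _∪ₐ_ : Assignment n k → Assignment n k → Assignment n k
  (f ∪ₐ g) v = f v ∪ g v

  ⋃ₐ : ∀ {m} → Vector (Assignment n k) m → Assignment n k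
  ⋃ₐ F v = ⋃ᵥ (λ i → F i v)

  point : Fin n → Subset k → Assignment n k
  point x S = updateAt ∅ₐ x (const S)

  ∑∣⊥∣≡0 : sum (λ (_ : Fin n) → ∣ ⊥ {k} ∣) ≡ 0
  ∑∣⊥∣≡0 = trans (sum-cong-≗ {n} (λ _ → ∣⊥∣≡0 k)) (sum-replicate-zero n)

  weight-∅ₐ : weight ∅ₐ ≡ 0
  weight-∅ₐ = trans (weight≡∑ ∅ₐ) ∑∣⊥∣≡0

  weight-∪ₐ : ∀ f g → weight (f ∪ₐ g) ≤ weight f + weight g
  weight-∪ₐ f g = begin
    weight (f ∪ₐ g)                              ≡⟨ weight≡∑ (f ∪ₐ g) ⟩
    sum (λ v → ∣ f v ∪ g v ∣)                    ≤⟨ ∑-mono-≤ (λ v → ∣p∪q∣≤∣p∣+∣q∣ (f v) (g v)) ⟩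
    sum (λ v → ∣ f v ∣ + ∣ g v ∣)                ≡⟨ ∑-distrib-+ (λ v → ∣ f v ∣) (λ v → ∣ g v ∣) ⟩
    sum (λ v → ∣ f v ∣) + sum (λ v → ∣ g v ∣)    ≡⟨ sym (cong₂ _+_ (weight≡∑ f) (weight≡∑ g)) ⟩
    weight f + weight g                          ∎
    where open ≤-Reasoning

  weight-⋃ₐ : ∀ {m} (F : Vector (Assignment n k) m) → weight (⋃ₐ F) ≤ sum (weight ∘ F)
  weight-⋃ₐ {zero}  F = ≤-reflexive weight-∅ₐ
  weight-⋃ₐ {suc m} F =
    ≤-trans (weight-∪ₐ (F zero) (⋃ₐ (F ∘ suc))) (+-monoʳ-≤ (weight (F zero)) (weight-⋃ₐ (F ∘ suc)))

weight-point : ∀ {n k} (x : Fin n) (S : Subset k) → weight (point x S) ≡ ∣ S ∣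
weight-point {k = k} x S = trans (weight≡∑ (point x S)) (∑-point x)
  where
  ∑-point : ∀ {n} (x : Fin n) → sum (λ v → ∣ point x S v ∣) ≡ ∣ S ∣
  ∑-point {suc n} zero    = trans (cong (∣ S ∣ +_) (∑∣⊥∣≡0 {n} {k})) (+-identityʳ ∣ S ∣)
  ∑-point (suc x) = cong₂ _+_ (∣⊥∣≡0 k) (∑-point x)

point-self : ∀ {n k} (x : Fin n) (S : Subset k) → point x S x ≡ S
point-self x S = updateAt-updates x ∅ₐ

NoIsolated : ∀ {n} → Digraph n → Set
NoIsolated D = ∀ v → ∃ λ u → Adj D v u

Adj-sym : ∀ {n} {D : Digraph n} {u v} → Adj D u v → Adj D v u
Adj-sym (inj₁ u→v) = inj₂ u→v
Adj-sym (inj₂ v→u) = inj₁ v→u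

module _ {n} {D : Digraph n} where

  Reach-trans : ∀ {u v w} → Reach D u v → Reach D v w → Reach D u w
  Reach-trans here             v⇝w = v⇝w
  Reach-trans (step u~u′ u′⇝v) v⇝w = step u~u′ (Reach-trans u′⇝v v⇝w)

  Reach-sym : ∀ {u v} → Reach D u v → Reach D v u
  Reach-sym here             = here
  Reach-sym (step u~u′ u′⇝v) = Reach-trans (Reach-sym u′⇝v) (step (Adj-sym {D = D} u~u′) here)

  hub⇒Connected : ∀ h → (∀ v → Reach D h v) → Connected D
  hub⇒Connected h h⇝ u v = Reach-trans (Reach-sym (h⇝ u)) (h⇝ v)

Connected⇒NoIsolated : ∀ {n} → 2 ≤ n → (D : Digraph n) → Connected D → NoIsolated D
Connected⇒NoIsolated (s≤s (s≤s z≤n)) D connected v =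
  firstStep (connected v (punchIn v zero)) (punchInᵢ≢i v zero ∘ sym)
  where
  firstStep : ∀ {u} → Reach D v u → ¬ v ≡ u → ∃ λ u′ → Adj D v u′
  firstStep here            v≢v = contradiction refl v≢v
  firstStep (step v~u′ _) _   = _ , v~u′

n≤weight : ∀ {n k} (f : Assignment n k) → (∀ v → ¬ f v ≡ ⊥) → n ≤ weight f
n≤weight {n} f noEmpty =
  subst₂ _≤_ (∑-ones n) (sym (weight≡∑ f)) (∑-mono-≤ (λ v → p≢⊥⇒1≤∣p∣ (noEmpty v)))

module _ {n k : ℕ} (D : Digraph n) where

  IsRDF-mono : {f g : Assignment n k} → IsRDF D f → (∀ v → f v ⊆ g v) → IsRDF D g
  IsRDF-mono fR f⊆g v gv≡⊥ c with fR v (p⊆q⇒q≡⊥⇒p≡⊥ (f⊆g v) gv≡⊥) c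
  ... | u , u→v , c∈fu = u , u→v , f⊆g u c∈fu

  IsRDF⇒IsTRDF : {f : Assignment n k} → NoIsolated D → IsRDF D f → (∀ v → ¬ f v ≡ ⊥) → IsTRDF D f
  IsRDF⇒IsTRDF noIsolated fR noEmpty = fR , λ v _ →
    let u , v~u = noIsolated v in u , noEmpty u , Adj-sym {D = D} v~u

  inLabels : Assignment n k → Fin n → Assignment n k
  inLabels f w v = if arc D v w then f v else ⊥

  inLabels⊆ : ∀ f w v → inLabels f w v ⊆ f v
  inLabels⊆ f w v with arc D v w
  ... | true  = id
  ... | false = λ x∈⊥ → contradiction x∈⊥ ∉⊥

  k≤∑inLabels : {f : Assignment n k} {w : Fin n} → IsRDF D f → f w ≡ ⊥ →
                k ≤ sum (λ v → ∣ inLabels f w v ∣)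
  k≤∑inLabels {f} {w} fR fw≡⊥ = ≤-trans (⊤⊆p⇒n≤∣p∣ ⊤⊆⋃) (∣⋃ᵥ∣≤∑ (inLabels f w))
    where
    ⊤⊆⋃ : ⊤ ⊆ ⋃ᵥ (inLabels f w)
    ⊤⊆⋃ {c} _ with fR w fw≡⊥ c
    ... | u , u→w , c∈fu =
      ∈⋃ᵥ (inLabels f w) u (subst (λ b → c ∈ (if b then f u else ⊥)) (sym u→w) c∈fu)

  IsRDF⇒k≤weight : k ≤ n → (f : Assignment n k) → IsRDF D f → k ≤ weight f
  IsRDF⇒k≤weight k≤n f fR with any? (λ w → f w ≟⊥)
  ... | yes (w , fw≡⊥) = begin
    k                               ≤⟨ k≤∑inLabels fR fw≡⊥ ⟩
    sum (λ v → ∣ inLabels f w v ∣)  ≤⟨ ∑-mono-≤ (λ v → p⊆q⇒∣p∣≤∣q∣ (inLabels⊆ f w v)) ⟩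
    sum (λ v → ∣ f v ∣)             ≡⟨ sym (weight≡∑ f) ⟩
    weight f                        ∎
    where open ≤-Reasoning
  ... | no  noEmpty    = ≤-trans k≤n (n≤weight f (λ v fv≡⊥ → noEmpty (v , fv≡⊥)))

IsRDF⇒labelledInNeighbour : ∀ {n k} (D : Digraph n) {f : Assignment n (suc k)} {v} →
  IsRDF D f → f v ≡ ⊥ → ∃ λ u → ¬ f u ≡ ⊥ × arc D u v ≡ true
IsRDF⇒labelledInNeighbour D fR fv≡⊥ with fR _ fv≡⊥ zero
... | u , u→v , 0∈fu = u , x∈p⇒p≢⊥ 0∈fu , u→v

module TotalRepair {n k} (D : Digraph n) (noIsolated : NoIsolated D)
  (f : Assignment n (suc k)) (fR : IsRDF D f) (w : Fin n) (fw≡⊥ : f w ≡ ⊥) where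

  mark : Fin n → Assignment n (suc k)
  mark x = point x ⁅ zero ⁆

  zero∈mark : ∀ x → zero ∈ mark x x
  zero∈mark x = subst (zero ∈_) (sym (point-self x ⁅ zero ⁆)) (x∈⁅x⁆ zero)

  weight-mark : ∀ x → weight (mark x) ≡ 1
  weight-mark x = trans (weight-point x ⁅ zero ⁆) (∣⁅x⁆∣≡1 {n = suc k} zero)

  neighbour : Fin n → Fin n
  neighbour v = proj₁ (noIsolated v)

  repair : Fin n → Assignment n (suc k)
  repair v with arc D v w | f v ≟⊥
  ... | true  | _     = ∅ₐ
  ... | false | yes _ = ∅ₐ
  ... | false | no  _ = mark (neighbour v)

  repaired : Assignment n (suc k)
  repaired = f ∪ₐ (mark w ∪ₐ ⋃ₐ repair)

  f⊆repaired : ∀ v → f v ⊆ repaired v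
  f⊆repaired v = p⊆p∪q _

  repair-marks : ∀ {v} → arc D v w ≡ false → ¬ f v ≡ ⊥ → repair v ≡ mark (neighbour v)
  repair-marks {v} v↛w fv≢⊥ with arc D v w | f v ≟⊥
  repair-marks ()  _     | true  | _
  repair-marks _   fv≢⊥ | false | yes fv≡⊥ = contradiction fv≡⊥ fv≢⊥
  repair-marks _   _     | false | no  _    = refl

  w-marked : zero ∈ repaired w
  w-marked = q⊆p∪q (f w) _ (p⊆p∪q _ (zero∈mark w))

  neighbour-marked : ∀ {v} → arc D v w ≡ false → ¬ f v ≡ ⊥ → zero ∈ repaired (neighbour v)
  neighbour-marked {v} v↛w fv≢⊥ =
    q⊆p∪q (f (neighbour v)) _ (q⊆p∪q (mark w (neighbour v)) _ (∈⋃ᵥ (λ u → repair u (neighbour v)) v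
      (subst (λ g → zero ∈ g (neighbour v)) (sym (repair-marks v↛w fv≢⊥)) (zero∈mark (neighbour v)))))

  repaired-IsTRDF : IsTRDF D repaired
  repaired-IsTRDF = IsRDF-mono D fR f⊆repaired , labelledNeighbour
    where
    labelledNeighbour : ∀ v → ¬ repaired v ≡ ⊥ → ∃ λ u → ¬ repaired u ≡ ⊥ × Adj D u v
    labelledNeighbour v _ with f v ≟⊥
    ... | yes fv≡⊥ with IsRDF⇒labelledInNeighbour D fR fv≡⊥
    ...   | u , fu≢⊥ , u→v = u , fu≢⊥ ∘ p⊆q⇒q≡⊥⇒p≡⊥ (f⊆repaired u) , inj₁ u→v
    labelledNeighbour v _ | no fv≢⊥ with arc D v w in v→w
    ...   | true  = w , x∈p⇒p≢⊥ w-marked , inj₂ v→w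
    ...   | false =
      neighbour v , x∈p⇒p≢⊥ (neighbour-marked v→w fv≢⊥) , Adj-sym {D = D} (proj₂ (noIsolated v))

  repair-cost : ∀ v → weight (repair v) + ∣ inLabels D f w v ∣ ≤ ∣ f v ∣
  repair-cost v with arc D v w | f v ≟⊥
  ... | true  | _        = ≤-reflexive (cong (_+ ∣ f v ∣) (weight-∅ₐ {n} {suc k}))
  ... | false | yes fv≡⊥ = ≤-trans (≤-reflexive (cong₂ _+_ (weight-∅ₐ {n} {suc k}) (∣⊥∣≡0 (suc k)))) z≤n
  ... | false | no  fv≢⊥ =
    ≤-trans (≤-reflexive (cong₂ _+_ (weight-mark (neighbour v)) (∣⊥∣≡0 (suc k)))) (p≢⊥⇒1≤∣p∣ fv≢⊥)

  repairs+k≤weight : sum (weight ∘ repair) + suc k ≤ weight f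
  repairs+k≤weight = begin
    sum (weight ∘ repair) + suc k                             ≤⟨ +-monoʳ-≤ _ (k≤∑inLabels D fR fw≡⊥) ⟩
    sum (weight ∘ repair) + sum (λ v → ∣ inLabels D f w v ∣)  ≡⟨ sym (∑-distrib-+ (weight ∘ repair) _) ⟩
    sum (λ v → weight (repair v) + ∣ inLabels D f w v ∣)      ≤⟨ ∑-mono-≤ repair-cost ⟩
    sum (λ v → ∣ f v ∣)                                       ≡⟨ sym (weight≡∑ f) ⟩
    weight f                                                  ∎
    where open ≤-Reasoning

  weight-repaired : weight repaired ≤ weight f + (1 + sum (weight ∘ repair))
  weight-repaired = ≤-trans (weight-∪ₐ f _) (+-monoʳ-≤ (weight f)
    (≤-trans (weight-∪ₐ (mark w) (⋃ₐ repair)) (+-mono-≤ (≤-reflexive (weight-mark w)) (weight-⋃ₐ repair))))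

  weight-repaired+k≤2*weight+1 : weight repaired + suc k ≤ 2 * weight f + 1
  weight-repaired+k≤2*weight+1 = begin
    weight repaired + suc k        ≤⟨ +-monoˡ-≤ (suc k) weight-repaired ⟩
    weight f + (1 + R) + suc k     ≡⟨ solve 3 (λ a r c → a :+ (con 1 :+ r) :+ c := a :+ con 1 :+ (r :+ c))
                                            refl (weight f) R (suc k) ⟩
    weight f + 1 + (R + suc k)     ≤⟨ +-monoʳ-≤ (weight f + 1) repairs+k≤weight ⟩
    weight f + 1 + weight f        ≡⟨ solve 1 (λ a → a :+ con 1 :+ a := con 2 :* a :+ con 1) refl (weight f) ⟩
    2 * weight f + 1               ∎
    where
    open ≤-Reasoning
    R = sum (weight ∘ repair)

a+k≤2*a+1 : ∀ {a k} → k ≤ a → a + k ≤ 2 * a + 1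
a+k≤2*a+1 {a} k≤a = ≤-trans (+-monoʳ-≤ a k≤a)
  (≤-trans (≤-reflexive (cong (a +_) (sym (+-identityʳ a)))) (m≤m+n (2 * a) 1))

∃IsTRDF-weight+k≤2*weight+1 : ∀ {n k} (D : Digraph n) → NoIsolated D → suc k ≤ n →
  (f : Assignment n (suc k)) → IsRDF D f →
  ∃ λ g → IsTRDF D g × weight g + suc k ≤ 2 * weight f + 1
∃IsTRDF-weight+k≤2*weight+1 D noIsolated k≤n f fR with any? (λ w → f w ≟⊥)
... | yes (w , fw≡⊥) = repaired , repaired-IsTRDF , weight-repaired+k≤2*weight+1
  where open TotalRepair D noIsolated f fR w fw≡⊥
... | no  noEmpty    = f , IsRDF⇒IsTRDF D noIsolated fR labelled ,
                       a+k≤2*a+1 (≤-trans k≤n (n≤weight f labelled))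
  where
  labelled : ∀ v → ¬ f v ≡ ⊥
  labelled v fv≡⊥ = noEmpty (v , fv≡⊥)

γrk≤γtrk : ∀ {n k} (D : Digraph n) {a b} → IsγRk k D a → IsγtRk k D b → a ≤ b
γrk≤γtrk D (_ , aMin) ((h , hT , weight-h≡b) , _) = subst (_ ≤_) weight-h≡b (aMin h (proj₁ hT))

γtrk+k≤2γrk+1 : ∀ {n k} (D : Digraph n) → NoIsolated D → suc k ≤ n → ∀ {a b} →
  IsγRk (suc k) D a → IsγtRk (suc k) D b → b + suc k ≤ 2 * a + 1
γtrk+k≤2γrk+1 {k = k} D noIsolated k≤n ((f , fR , weight-f≡a) , _) (_ , bMin)
  with g , gT , weight-g+k≤ ← ∃IsTRDF-weight+k≤2*weight+1 D noIsolated k≤n f fR =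
  ≤-trans (+-monoˡ-≤ (suc k) (bMin g gT))
          (subst (λ a → weight g + suc k ≤ 2 * a + 1) weight-f≡a weight-g+k≤)

outStar : (m : ℕ) → Digraph (suc m)
outStar m = record { arc = spoke ; loopless = λ { zero → refl ; (suc _) → refl } }
  where
  spoke : Fin (suc m) → Fin (suc m) → Bool
  spoke zero (suc _) = true
  spoke _    _       = false

outStar-connected : ∀ m → Connected (outStar m)
outStar-connected m = hub⇒Connected zero λ
  { zero    → here
  ; (suc _) → step (inj₁ refl) here
  }

outStar-centre : ∀ {m} {u v : Fin (suc m)} → arc (outStar m) u v ≡ true → u ≡ zero
outStar-centre {u = zero} _ = refl

⊤⊆centre : ∀ {m k} {f : Assignment (suc m) k} {v} → IsRDF (outStar m) f → f v ≡ ⊥ → ⊤ ⊆ f zero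
⊤⊆centre {f = f} fR fv≡⊥ {c} _ with fR _ fv≡⊥ c
... | u , u→v , c∈fu = subst (λ x → c ∈ f x) (outStar-centre u→v) c∈fu

outStar-IsTRDF⇒k+1≤weight : ∀ {m k} → suc k ≤ m → (f : Assignment (suc m) (suc k)) →
  IsTRDF (outStar m) f → suc (suc k) ≤ weight f
outStar-IsTRDF⇒k+1≤weight {suc m} {k} (s≤s k≤m) f (fR , fT) with any? (λ v → f v ≟⊥)
... | no  noEmpty    = ≤-trans (s≤s (s≤s k≤m)) (n≤weight f (λ v fv≡⊥ → noEmpty (v , fv≡⊥)))
... | yes (v , fv≡⊥) with fT zero (x∈p⇒p≢⊥ (⊤⊆centre fR fv≡⊥ (∈⊤ {x = zero})))
...   | zero  , _     , inj₁ ()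
...   | zero  , _     , inj₂ ()
...   | suc u , fu≢⊥ , _ = subst (suc (suc k) ≤_) (sym (weight≡∑ f)) (begin
  suc (suc k)                       ≡⟨ +-comm 1 (suc k) ⟩
  suc k + 1                         ≤⟨ +-mono-≤ (⊤⊆p⇒n≤∣p∣ (⊤⊆centre fR fv≡⊥))
                                                (≤-trans (p≢⊥⇒1≤∣p∣ fu≢⊥) (lookup≤∑ (λ i → ∣ f (suc i) ∣) u)) ⟩
  ∣ f zero ∣ + sum (λ i → ∣ f (suc i) ∣) ∎)
  where open ≤-Reasoning

Realisable : ℕ → (ℕ → ℕ → Set) → Set
Realisable k R = ∃ λ (n : ℕ) → (k ⊔ 2) ≤ n × Σ (Digraph n) λ D → Connected D ×
                 ∃ λ (a : ℕ) → ∃ λ (b : ℕ) → IsγRk k D a × IsγtRk k D b × R a b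

module _ {k : ℕ} where

  centreOnly : Assignment (suc (suc k)) (suc k)
  centreOnly = point zero ⊤

  centreOnly-IsRDF : IsRDF (outStar (suc k)) centreOnly
  centreOnly-IsRDF zero    ⊤≡⊥ = contradiction ⊤≡⊥ (x∈p⇒p≢⊥ (∈⊤ {x = zero}))
  centreOnly-IsRDF (suc v) _   c = zero , refl , ∈⊤

  weight-centreOnly : weight centreOnly ≡ suc k
  weight-centreOnly = trans (weight-point {suc (suc k)} zero (⊤ {suc k})) (∣⊤∣≡n (suc k))

  centreAndLeaf : Assignment (suc (suc k)) (suc k)
  centreAndLeaf zero          = ⊤
  centreAndLeaf (suc zero)    = ⁅ zero ⁆
  centreAndLeaf (suc (suc _)) = ⊥

  centreAndLeaf-IsTRDF : IsTRDF (outStar (suc k)) centreAndLeaf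
  centreAndLeaf-IsTRDF = IsRDF-mono (outStar (suc k)) centreOnly-IsRDF centreOnly⊆ , labelledNeighbour
    where
    centreOnly⊆ : ∀ v → centreOnly v ⊆ centreAndLeaf v
    centreOnly⊆ zero          = id
    centreOnly⊆ (suc zero)    = λ x∈⊥ → contradiction x∈⊥ ∉⊥
    centreOnly⊆ (suc (suc _)) = id
    labelledNeighbour : ∀ v → ¬ centreAndLeaf v ≡ ⊥ →
      ∃ λ u → ¬ centreAndLeaf u ≡ ⊥ × Adj (outStar (suc k)) u v
    labelledNeighbour zero          _   = suc zero , x∈p⇒p≢⊥ (x∈⁅x⁆ zero) , inj₂ refl
    labelledNeighbour (suc zero)    _   = zero , x∈p⇒p≢⊥ (∈⊤ {x = zero}) , inj₁ refl
    labelledNeighbour (suc (suc _)) ⊥≢⊥ = contradiction refl ⊥≢⊥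

  weight-centreAndLeaf : weight centreAndLeaf ≡ suc (suc k)
  weight-centreAndLeaf = begin
    weight centreAndLeaf                 ≡⟨ weight≡∑ centreAndLeaf ⟩
    ∣ ⊤ {suc k} ∣ + (∣ ⁅ zero {n = k} ⁆ ∣ + sum (λ (_ : Fin k) → ∣ ⊥ {suc k} ∣))
      ≡⟨ cong₂ _+_ (∣⊤∣≡n (suc k)) (cong₂ _+_ (∣⁅x⁆∣≡1 {n = suc k} zero) (∑∣⊥∣≡0 {k} {suc k})) ⟩
    suc k + 1                            ≡⟨ +-comm (suc k) 1 ⟩
    suc (suc k)                          ∎
    where open ≡-Reasoning

  outStar-realises-γtrk+k≡2γrk+1 : Realisable (suc k) (λ a b → b + suc k ≡ 2 * a + 1)
  outStar-realises-γtrk+k≡2γrk+1 =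
    suc (suc k) , ⊔-lub (n≤1+n _) (s≤s (s≤s z≤n)) , outStar (suc k) , outStar-connected (suc k) ,
    suc k , suc (suc k) ,
    ((centreOnly , centreOnly-IsRDF , weight-centreOnly) ,
      IsRDF⇒k≤weight (outStar (suc k)) (n≤1+n _)) ,
    ((centreAndLeaf , centreAndLeaf-IsTRDF , weight-centreAndLeaf) ,
      outStar-IsTRDF⇒k+1≤weight ≤-refl) ,
    solve 1 (λ x → con 1 :+ x :+ x := con 2 :* x :+ con 1) refl (suc k)

γtrk+k≡2γrk+1-realisable : ∀ k → 1 ≤ k → Realisable k (λ a b → b + k ≡ 2 * a + 1)
γtrk+k≡2γrk+1-realisable (suc k) _ = outStar-realises-γtrk+k≡2γrk+1

firstColour : ∀ {n k} → Assignment n (suc k)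
firstColour _ = ⁅ zero ⁆

weight-firstColour : ∀ {n k} → weight (firstColour {n} {k}) ≡ n
weight-firstColour {n} {k} =
  trans (weight≡∑ (firstColour {n} {k}))
        (trans (sum-cong-≗ {n} (λ _ → ∣⁅x⁆∣≡1 {n = suc k} zero)) (∑-ones n))

firstColour-IsTRDF : ∀ {n k} → 2 ≤ n → (D : Digraph n) → Connected D → IsTRDF D (firstColour {n} {k})
firstColour-IsTRDF 2≤n D connected =
  IsRDF⇒IsTRDF D (Connected⇒NoIsolated 2≤n D connected)
                 (λ _ ⁅0⁆≡⊥ → contradiction ⁅0⁆≡⊥ labelled) (λ _ → labelled)
  where
  labelled : ¬ ⁅ zero ⁆ ≡ ⊥
  labelled = x∈p⇒p≢⊥ (x∈⁅x⁆ zero)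

path : Digraph 3
path = record
  { arc      = pathArc
  ; loopless = λ { zero → refl ; (suc zero) → refl ; (suc (suc zero)) → refl }
  }
  where
  pathArc : Fin 3 → Fin 3 → Bool
  pathArc zero       (suc zero)       = true
  pathArc (suc zero) (suc (suc zero)) = true
  pathArc _          _                = false

path-connected : Connected path
path-connected = hub⇒Connected (suc zero) λ
  { zero             → step (inj₂ refl) here
  ; (suc zero)       → here
  ; (suc (suc zero)) → step (inj₁ refl) here
  }

pathLabelling : Assignment 3 1
pathLabelling zero             = ⁅ zero ⁆
pathLabelling (suc zero)       = ⁅ zero ⁆
pathLabelling (suc (suc zero)) = ⊥

pathLabelling-IsTRDF : IsTRDF path pathLabelling
pathLabelling-IsTRDF = dominating , labelledNeighbour
  where
  dominating : IsRDF path pathLabelling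
  dominating (suc (suc zero)) _ zero = suc zero , refl , x∈⁅x⁆ zero
  labelledNeighbour : ∀ v → ¬ pathLabelling v ≡ ⊥ → ∃ λ u → ¬ pathLabelling u ≡ ⊥ × Adj path u v
  labelledNeighbour zero             _   = suc zero , (λ ()) , inj₂ refl
  labelledNeighbour (suc zero)       _   = zero , (λ ()) , inj₁ refl
  labelledNeighbour (suc (suc zero)) ⊥≢⊥ = contradiction refl ⊥≢⊥

path-IsRDF⇒2≤weight : (f : Assignment 3 1) → IsRDF path f → 2 ≤ weight f
path-IsRDF⇒2≤weight f fR =
  subst (2 ≤_) (sym (weight≡∑ f)) (+-mono-≤ (p≢⊥⇒1≤∣p∣ source-labelled) tail-labelled)
  where
  source-labelled : ¬ f zero ≡ ⊥
  source-labelled f0≡⊥ with IsRDF⇒labelledInNeighbour path fR f0≡⊥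
  ... | zero , _ , ()
  ... | suc zero , _ , ()
  ... | suc (suc zero) , _ , ()
  tail-labelled : 1 ≤ ∣ f (suc zero) ∣ + (∣ f (suc (suc zero)) ∣ + 0)
  tail-labelled with f (suc (suc zero)) ≟⊥
  ... | no  f2≢⊥ = ≤-trans (≤-trans (p≢⊥⇒1≤∣p∣ f2≢⊥) (m≤m+n _ 0)) (m≤n+m _ ∣ f (suc zero) ∣)
  ... | yes f2≡⊥ with IsRDF⇒labelledInNeighbour path fR f2≡⊥
  ...   | suc zero , f1≢⊥ , _ = ≤-trans (p≢⊥⇒1≤∣p∣ f1≢⊥) (m≤m+n _ _)
  ...   | zero , _ , ()
  ...   | suc (suc zero) , _ , ()

γrk≡γtrk-realisable : ∀ k → 1 ≤ k → Realisable k _≡_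
γrk≡γtrk-realisable (suc zero) _ =
  3 , n≤1+n 2 , path , path-connected , 2 , 2 ,
  ((pathLabelling , proj₁ pathLabelling-IsTRDF , refl) , path-IsRDF⇒2≤weight) ,
  ((pathLabelling , pathLabelling-IsTRDF , refl) , (λ f fT → path-IsRDF⇒2≤weight f (proj₁ fT))) ,
  refl
γrk≡γtrk-realisable (suc (suc j)) _ =
  suc (suc j) , ⊔-lub ≤-refl (s≤s (s≤s z≤n)) , outStar (suc j) , outStar-connected (suc j) ,
  suc (suc j) , suc (suc j) ,
  ((firstColour , proj₁ firstColour-TRDF , weight-firstColour {k = suc j}) , γrk-lower) ,
  ((firstColour , firstColour-TRDF , weight-firstColour {k = suc j}) , (λ f fT → γrk-lower f (proj₁ fT))) ,
  refl
  where
  firstColour-TRDF : IsTRDF (outStar (suc j)) firstColour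
  firstColour-TRDF = firstColour-IsTRDF (s≤s (s≤s z≤n)) (outStar (suc j)) (outStar-connected (suc j))
  γrk-lower : (f : Assignment (suc (suc j)) (suc (suc j))) → IsRDF (outStar (suc j)) f → suc (suc j) ≤ weight f
  γrk-lower = IsRDF⇒k≤weight (outStar (suc j)) ≤-refl

γrk≤γtrk≤2γrk-k+1 : ∀ (k n : ℕ) → 1 ≤ k → (k ⊔ 2) ≤ n → (D : Digraph n) → Connected D →
  ∀ (a b : ℕ) → IsγRk k D a → IsγtRk k D b → (a ≤ b) × (b + k ≤ 2 * a + 1)
γrk≤γtrk≤2γrk-k+1 (suc k) n _ k⊔2≤n D connected a b γ γt =
  γrk≤γtrk D γ γt ,
  γtrk+k≤2γrk+1 D (Connected⇒NoIsolated (≤-trans (m≤n⊔m (suc k) 2) k⊔2≤n) D connected)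
                  (≤-trans (m≤m⊔n (suc k) 2) k⊔2≤n) γ γt

theorem2p3 :
    (∀ (k n : ℕ) → 1 ≤ k → (k ⊔ 2) ≤ n → (D : Digraph n) → Connected D →
       ∀ (a b : ℕ) → IsγRk k D a → IsγtRk k D b →
       (a ≤ b) × (b + k ≤ 2 * a + 1))
    ×
    (∀ (k : ℕ) → 1 ≤ k →
       (∃ λ (n : ℕ) → (k ⊔ 2) ≤ n × Σ (Digraph n) λ D → Connected D ×
          ∃ λ (a : ℕ) → ∃ λ (b : ℕ) → IsγRk k D a × IsγtRk k D b × a ≡ b)
       ×
       (∃ λ (n : ℕ) → (k ⊔ 2) ≤ n × Σ (Digraph n) λ D → Connected D ×
          ∃ λ (a : ℕ) → ∃ λ (b : ℕ) → IsγRk k D a × IsγtRk k D b × b + k ≡ 2 * a + 1))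
theorem2p3 =
  γrk≤γtrk≤2γrk-k+1 , λ k 1≤k → γrk≡γtrk-realisable k 1≤k , γtrk+k≡2γrk+1-realisable k 1≤k
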